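{- Let $p\in(0,\tfrac12]$, $r\ge1$, $\delta>0$, and let $f\colon\{0,1\}^n\to\{0,1\}$ be an $(r,\delta)$-global Boolean function with $\mu_p(f)\le\delta$. Then for all $S\subseteq[n]$ with $|S|\le r$, \[\mathrm{I}_S(f^{\le r})\le\mathrm{I}_S(f)\le8^r\delta.\]
   Context: $\mu_p$ is the $p$-biased product measure on $\{0,1\}^n$ and $\mu_p(f)=\mathbb{E}_{\mu_p}[f]$. $f$ is $(r,\delta)$-global if $\mu_p(f_{J\to1})\le\mu_p(f)+\delta$ for every $J\subseteq[n]$ with $|J|\le r$, where $f_{J\to1}$ sets the coordinates of $J$ to $1$. With $\sigma=\sqrt{p(1-p)}$, $\chi_S=\prod_{i\in S}(x_i-p)/\sigma$ and $f=\sum_S\hat f(S)\chi_S$, $f^{\le r}=\sum_{|S|\le r}\hat f(S)\chi_S$. The generalised influence is $\mathrm{I}_S(g)=\mathbb{E}_{\mu_p}[(\sum_{x\in\{0,1\}^S}(-1)^{|S|-|x|}g_{S\to x})^2]=\sigma^{ -2|S|}\sum_{T\supseteq S}\hat g(T)^2$, where $g_{S\to x}$ fixes the coordinates of $S$ to $x$.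
   Formalization: The bias $p\in(0,\tfrac12]$ and the parameter $\delta>0$ range over the rationals. -}

module Defs where

open import Data.Bool using (Bool; true; false; if_then_else_; _∧_; not)
open import Data.Nat as ℕ using (ℕ; zero; suc)
open import Data.Integer using (+_)
open import Data.Vec using (Vec; []; _∷_; zipWith)
open import Data.List using (List; []; _∷_; map; _++_)
open import Data.Rational using (ℚ; 0ℚ; 1ℚ; _+_; _*_; _-_; -_; 1/_; ≢-nonZero; _/_)
open import Data.Rational.Properties using (_≟_)
open import Relation.Nullary using (yes; no)
open import Data.Fin.Subset using (Subset; ∣_∣)

-- The discrete cube {0,1}^n (true = 1, false = 0).
Cube : ℕ → Set
Cube n = Vec Bool n

allPoints : (n : ℕ) → List (Cube n)
allPoints zero    = [] ∷ []
allPoints (suc n) = map (false ∷_) (allPoints n) ++ map (true ∷_) (allPoints n)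

Σ[_]_ : {A : Set} → List A → (A → ℚ) → ℚ
Σ[ []     ] g = 0ℚ
Σ[ a ∷ as ] g = g a + Σ[ as ] g

prodVec : {n : ℕ} → Vec ℚ n → ℚ
prodVec []       = 1ℚ
prodVec (q ∷ qs) = q * prodVec qs

_^ℚ_ : ℚ → ℕ → ℚ
q ^ℚ zero  = 1ℚ
q ^ℚ suc k = q * (q ^ℚ k)

-- Total inverse (the value at 0 is irrelevant; only used for p(1-p) ≠ 0).
inv : ℚ → ℚ
inv q with q ≟ 0ℚ
... | yes _  = 0ℚ
... | no q≢0 = 1/_ q {{≢-nonZero q≢0}}

bit : Bool → ℚ
bit true  = 1ℚ
bit false = 0ℚ

weight : {n : ℕ} → ℚ → Cube n → ℚ
weight p x = prodVec (Data.Vec.map (λ b → if b then p else (1ℚ - p)) x)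

𝔼[_]_ : {n : ℕ} → ℚ → (Cube n → ℚ) → ℚ
𝔼[_]_ {n} p g = Σ[ allPoints n ] (λ x → weight p x * g x)

μ : {n : ℕ} → ℚ → (Cube n → ℚ) → ℚ
μ p g = 𝔼[ p ] g

card : {n : ℕ} → Vec Bool n → ℕ
card []           = 0
card (true ∷ xs)  = suc (card xs)
card (false ∷ xs) = card xs

override : {n : ℕ} → Subset n → Cube n → Cube n → Cube n
override S z x = zipWith3 S z x
  where
  zipWith3 : {m : ℕ} → Vec Bool m → Vec Bool m → Vec Bool m → Vec Bool m
  zipWith3 []       []       []       = []
  zipWith3 (s ∷ ss) (a ∷ as) (b ∷ bs) = (if s then a else b) ∷ zipWith3 ss as bs

ones : (n : ℕ) → Cube n
ones zero    = []
ones (suc n) = true ∷ ones n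

-- g_{J→1}: the restriction setting the coordinates of J to 1
-- (viewed as a function on the whole cube not depending on J).
restrict1 : {n : ℕ} → Subset n → (Cube n → ℚ) → (Cube n → ℚ)
restrict1 {n} J g x = g (override J (ones n) x)

-- g_{S→z}, for z an assignment to the coordinates of S
-- (z is a point of the cube; only its coordinates in S matter).
restrict : {n : ℕ} → Subset n → Cube n → (Cube n → ℚ) → (Cube n → ℚ)
restrict S z g x = g (override S z x)

-- z ⊆ S (z is supported on S): enumerates the assignments x ∈ {0,1}^S.
supportedIn : {n : ℕ} → Subset n → Cube n → Bool
supportedIn []       []       = true
supportedIn (s ∷ ss) (z ∷ zs) = (not z Data.Bool.∨ s) ∧ supportedIn ss zs

assignments : {n : ℕ} → Subset n → List (Cube n)
assignments {n} S = Data.List.filterᵇ (supportedIn S) (allPoints n)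

sign : ℕ → ℚ
sign zero    = 1ℚ
sign (suc k) = - sign k

I[_,_]_ : {n : ℕ} → ℚ → Subset n → (Cube n → ℚ) → ℚ
I[ p , S ] g = 𝔼[ p ] (λ y → let d = Σ[ assignments S ] (λ z → sign (∣ S ∣ ℕ.∸ card z) * restrict S z g y) in d * d)

centered : {n : ℕ} → ℚ → Subset n → Cube n → ℚ
centered p S x = prodVec (zipWith (λ s b → if s then (bit b - p) else 1ℚ) S x)

-- The Fourier term \hat g(S) χ_S(x), where σ² = p(1-p),
-- χ_S(x) = ∏_{i∈S}(x_i - p)/σ and \hat g(S) = E_{μ_p}[g χ_S] (orthonormality):
-- \hat g(S) χ_S(x) = σ^{-2|S|} E_y[g(y) ∏_{i∈S}(y_i-p)] ∏_{i∈S}(x_i-p).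
fourierTerm : {n : ℕ} → ℚ → (Cube n → ℚ) → Subset n → Cube n → ℚ
fourierTerm p g S x =
  inv ((p * (1ℚ - p)) ^ℚ ∣ S ∣) * (𝔼[ p ] (λ y → g y * centered p S y)) * centered p S x

lowDeg : {n : ℕ} → ℚ → ℕ → (Cube n → ℚ) → (Cube n → ℚ)
lowDeg {n} p r g x =
  Σ[ allPoints n ] (λ S → if ∣ S ∣ ℕ.≤ᵇ r then fourierTerm p g S x else 0ℚ)

toℚ : {n : ℕ} → (Cube n → Bool) → (Cube n → ℚ)
toℚ f x = bit (f x)

IsGlobal : {n : ℕ} → ℚ → ℕ → ℚ → (Cube n → ℚ) → Set
IsGlobal {n} p r δ g =
  (J : Subset n) → ∣ J ∣ ℕ.≤ r → μ p (restrict1 J g) Data.Rational.≤ μ p g + δ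

{-# OPTIONS --safe #-}

-- Everything is computed by conditioning on one coordinate at a time. Write a function
-- as g = A + (x₁ - p) C, where A averages out x₁ and C = g(1,·) - g(0,·); the two parts
-- are orthogonal under μ_p. Hence I_S(g) = I_S(A) + p(1-p) I_S(C) when 1 ∉ S and
-- I_S(g) = I_{S∖1}(C) when 1 ∈ S. Truncation to degree ≤ r sends A to A^{≤r} and C to
-- C^{≤r-1}, so induction on S gives I_S(f^{≤r}) ≤ I_S(f).
--
-- For the bound, (a - b)² ≤ 2a² + 2b² (and ≤ a² + b² for a, b ≥ 0, used once) bounds
-- I_S(f) by 2^{|S|-1} times the sum over all z ∈ {0,1}^S of E[f_{S→z}²] = E[f_{S→z}].
-- When p ≤ ½ and f ≥ 0, f(0,·) + f(1,·) ≤ 2·avg f + f(1,·), so this sum is at most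
-- Σ_{J ⊆ S} 2^{|S∖J|} μ_p(f_{J→1}). Globality bounds each term by 2δ, giving
-- 2^{|S|-1} · 3^{|S|} · 2δ ≤ 8^r δ.

module Submission where

open import Defs
open import Data.Bool using (Bool; true; false; if_then_else_)
open import Data.Nat using (ℕ; zero; suc; _^_; _∸_; z≤n; s≤s)
import Data.Nat as ℕ
import Data.Nat.Properties as ℕₚ
import Data.Nat.Tactic.RingSolver as ℕ-Solver
open import Data.Integer as ℤ using (+_)
import Data.Integer.Properties as ℤₚ
open import Data.Rational using (ℚ; 0ℚ; 1ℚ; ½; _≤_; _<_; _*_; _/_; _+_; _-_; -_; toℚᵘ; nonNegative; positive; ≢-nonZero; *<*)
open import Data.Rational.Properties
import Data.Rational.Unnormalised as ℚᵘ
import Data.Rational.Unnormalised.Properties as ℚᵘₚ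
open import Data.Fin.Subset using (Subset; ∣_∣)
open import Data.Product using (_×_; _,_)
open import Data.Sum using (inj₁; inj₂)
open import Data.Vec using ([]; _∷_)
open import Data.List using (List; []; _∷_; map; _++_; filterᵇ)
open import Data.Empty using (⊥-elim)
open import Function using (_∘_)
open import Level using (0ℓ)
open import Relation.Nullary using (yes; no)
open import Relation.Nullary.Decidable using (dec⇒maybe)
open import Relation.Binary.PropositionalEquality
open import Tactic.RingSolver using (solve-∀)
open import Tactic.RingSolver.Core.AlmostCommutativeRing using (AlmostCommutativeRing; fromCommutativeRing)

ℚ-ring : AlmostCommutativeRing 0ℓ 0ℓ
ℚ-ring = fromCommutativeRing +-*-commutativeRing (λ x → dec⇒maybe (0ℚ ≟ x))

*-monoˡ-≤-0≤ : ∀ {c a b} → 0ℚ ≤ c → a ≤ b → c * a ≤ c * b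
*-monoˡ-≤-0≤ {c} 0≤c = *-monoˡ-≤-nonNeg c {{nonNegative 0≤c}}

*-nonNeg : ∀ {a b} → 0ℚ ≤ a → 0ℚ ≤ b → 0ℚ ≤ a * b
*-nonNeg {a} {b} 0≤a 0≤b = nonNegative⁻¹ (a * b) {{nonNeg*nonNeg⇒nonNeg a {{nonNegative 0≤a}} b {{nonNegative 0≤b}}}}

*-pos : ∀ {a b} → 0ℚ < a → 0ℚ < b → 0ℚ < a * b
*-pos {a} {b} 0<a 0<b = positive⁻¹ (a * b) {{pos*pos⇒pos a {{positive 0<a}} b {{positive 0<b}}}}

square-nonNeg : ∀ a → 0ℚ ≤ a * a
square-nonNeg a with ≤-total 0ℚ a
... | inj₁ 0≤a = *-nonNeg 0≤a 0≤a
... | inj₂ a≤0 = subst (0ℚ ≤_) (neg-square a) (*-nonNeg 0≤-a 0≤-a)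
  where
  0≤-a : 0ℚ ≤ - a
  0≤-a = neg-antimono-≤ a≤0
  neg-square : ∀ a → (- a) * (- a) ≡ a * a
  neg-square = solve-∀ ℚ-ring

p≤½⇒0<1-p : ∀ {p} → p ≤ ½ → 0ℚ < 1ℚ - p
p≤½⇒0<1-p {p} p≤½ = subst (_< 1ℚ - p) (+-inverseʳ p) (+-monoˡ-< (- p) (≤-<-trans p≤½ ½<1))
  where
  ½<1 : ½ < 1ℚ
  ½<1 = *<* (ℤ.+<+ (s≤s (s≤s z≤n)))

≤-by-nonNeg-gap : ∀ {x y} d → y ≡ x + d → 0ℚ ≤ d → x ≤ y
≤-by-nonNeg-gap {x} d refl 0≤d = subst (_≤ x + d) (+-identityʳ x) (+-monoʳ-≤ x 0≤d)

^ℚ-pos : ∀ {c} → 0ℚ < c → ∀ k → 0ℚ < c ^ℚ k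
^ℚ-pos 0<c zero    = *<* (ℤ.+<+ (s≤s z≤n))
^ℚ-pos 0<c (suc k) = *-pos 0<c (^ℚ-pos 0<c k)

inv-inverseˡ : ∀ x → x ≢ 0ℚ → inv x * x ≡ 1ℚ
inv-inverseˡ x x≢0 with x ≟ 0ℚ
... | yes x≡0 = ⊥-elim (x≢0 x≡0)
... | no x≢0′ = *-inverseˡ x {{≢-nonZero x≢0′}}

inv-unique : ∀ x y → x ≢ 0ℚ → y * x ≡ 1ℚ → inv x ≡ y
inv-unique x y x≢0 yx≡1 = begin
  inv x            ≡⟨ sym (*-identityʳ (inv x)) ⟩
  inv x * 1ℚ       ≡⟨ cong (inv x *_) (sym yx≡1) ⟩
  inv x * (y * x)  ≡⟨ swap (inv x) y x ⟩
  y * (inv x * x)  ≡⟨ cong (y *_) (inv-inverseˡ x x≢0) ⟩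
  y * 1ℚ           ≡⟨ *-identityʳ y ⟩
  y                ∎
  where
  open ≡-Reasoning
  swap : ∀ i y x → i * (y * x) ≡ y * (i * x)
  swap = solve-∀ ℚ-ring

inv-*-cancelˡ : ∀ c e → c * e ≢ 0ℚ → e ≢ 0ℚ → inv (c * e) * c ≡ inv e
inv-*-cancelˡ c e ce≢0 e≢0 =
  sym (inv-unique e (inv (c * e) * c) e≢0 (trans (*-assoc (inv (c * e)) c e) (inv-inverseˡ (c * e) ce≢0)))

fromℕ : ℕ → ℚ
fromℕ m = + m / 1

private
  toℚᵘ-fromℕ : ∀ m → toℚᵘ (fromℕ m) ℚᵘ.≃ ℚᵘ.mkℚᵘ (+ m) 0
  toℚᵘ-fromℕ m = toℚᵘ-fromℚᵘ (ℚᵘ.mkℚᵘ (+ m) 0)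

fromℕ-* : ∀ m n → fromℕ (m ℕ.* n) ≡ fromℕ m * fromℕ n
fromℕ-* m n = toℚᵘ-injective (begin
  toℚᵘ (fromℕ (m ℕ.* n))               ≈⟨ toℚᵘ-fromℕ (m ℕ.* n) ⟩
  ℚᵘ.mkℚᵘ (+ (m ℕ.* n)) 0              ≈⟨ ℚᵘ.*≡* (cong (ℤ._* + 1) (ℤₚ.pos-* m n)) ⟩
  ℚᵘ.mkℚᵘ (+ m) 0 ℚᵘ.* ℚᵘ.mkℚᵘ (+ n) 0 ≈⟨ ℚᵘₚ.*-cong (ℚᵘₚ.≃-sym (toℚᵘ-fromℕ m)) (ℚᵘₚ.≃-sym (toℚᵘ-fromℕ n)) ⟩
  toℚᵘ (fromℕ m) ℚᵘ.* toℚᵘ (fromℕ n)   ≈⟨ ℚᵘₚ.≃-sym (toℚᵘ-homo-* (fromℕ m) (fromℕ n)) ⟩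
  toℚᵘ (fromℕ m * fromℕ n)             ∎)
  where open ℚᵘₚ.≃-Reasoning

fromℕ-mono-≤ : ∀ {m n} → m ℕ.≤ n → fromℕ m ≤ fromℕ n
fromℕ-mono-≤ {m} {n} m≤n = toℚᵘ-cancel-≤ (begin
  toℚᵘ (fromℕ m)   ≃⟨ toℚᵘ-fromℕ m ⟩
  ℚᵘ.mkℚᵘ (+ m) 0  ≤⟨ ℚᵘ.*≤* (ℤₚ.*-monoʳ-≤-nonNeg (+ 1) (ℤ.+≤+ m≤n)) ⟩
  ℚᵘ.mkℚᵘ (+ n) 0  ≃⟨ ℚᵘₚ.≃-sym (toℚᵘ-fromℕ n) ⟩
  toℚᵘ (fromℕ n)   ∎)
  where open ℚᵘₚ.≤-Reasoning

fromℕ-nonNeg : ∀ m → 0ℚ ≤ fromℕ m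
fromℕ-nonNeg m = fromℕ-mono-≤ {0} {m} z≤n

bit-nonNeg : ∀ b → 0ℚ ≤ bit b
bit-nonNeg true  = fromℕ-nonNeg 1
bit-nonNeg false = ≤-refl

bit-square : ∀ b → bit b * bit b ≡ bit b
bit-square true  = refl
bit-square false = refl

Σ-cong : ∀ {A : Set} (xs : List A) {g h : A → ℚ} → (∀ x → g x ≡ h x) → Σ[ xs ] g ≡ Σ[ xs ] h
Σ-cong []       g≗h = refl
Σ-cong (x ∷ xs) g≗h = cong₂ _+_ (g≗h x) (Σ-cong xs g≗h)

Σ-++ : ∀ {A : Set} (xs ys : List A) (g : A → ℚ) → Σ[ xs ++ ys ] g ≡ Σ[ xs ] g + Σ[ ys ] g
Σ-++ []       ys g = sym (+-identityˡ _)
Σ-++ (x ∷ xs) ys g = trans (cong (_+_ (g x)) (Σ-++ xs ys g)) (sym (+-assoc (g x) _ _))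

Σ-map : ∀ {A B : Set} (h : A → B) (xs : List A) (g : B → ℚ) → Σ[ map h xs ] g ≡ Σ[ xs ] (g ∘ h)
Σ-map h []       g = refl
Σ-map h (x ∷ xs) g = cong (_+_ (g (h x))) (Σ-map h xs g)

Σ-+ : ∀ {A : Set} (xs : List A) (g h : A → ℚ) → Σ[ xs ] (λ x → g x + h x) ≡ Σ[ xs ] g + Σ[ xs ] h
Σ-+ []       g h = refl
Σ-+ (x ∷ xs) g h = trans (cong (_+_ (g x + h x)) (Σ-+ xs g h)) (interchange (g x) (h x) _ _)
  where
  interchange : ∀ a b c d → a + b + (c + d) ≡ a + c + (b + d)
  interchange = solve-∀ ℚ-ring

Σ-scale : ∀ {A : Set} (xs : List A) a (g : A → ℚ) → Σ[ xs ] (λ x → a * g x) ≡ a * Σ[ xs ] g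
Σ-scale []       a g = sym (*-zeroʳ a)
Σ-scale (x ∷ xs) a g = trans (cong (_+_ (a * g x)) (Σ-scale xs a g)) (sym (*-distribˡ-+ a (g x) _))

Σ-zero : ∀ {A : Set} (xs : List A) → Σ[ xs ] (λ _ → 0ℚ) ≡ 0ℚ
Σ-zero []       = refl
Σ-zero (x ∷ xs) = trans (+-identityˡ _) (Σ-zero xs)

Σ-filterᵇ : ∀ {A : Set} (P : A → Bool) (xs : List A) (g : A → ℚ) →
            Σ[ filterᵇ P xs ] g ≡ Σ[ xs ] (λ x → if P x then g x else 0ℚ)
Σ-filterᵇ P []       g = refl
Σ-filterᵇ P (x ∷ xs) g with P x
... | true  = cong (_+_ (g x)) (Σ-filterᵇ P xs g)
... | false = trans (Σ-filterᵇ P xs g) (sym (+-identityˡ _))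

Σ-allPoints : ∀ {n} (g : Cube (suc n) → ℚ) →
              Σ[ allPoints (suc n) ] g ≡ Σ[ allPoints n ] (g ∘ (false ∷_)) + Σ[ allPoints n ] (g ∘ (true ∷_))
Σ-allPoints {n} g = trans (Σ-++ (map (false ∷_) (allPoints n)) _ g)
                          (cong₂ _+_ (Σ-map (false ∷_) (allPoints n) g) (Σ-map (true ∷_) (allPoints n) g))

Δ : ∀ {n} → (Cube (suc n) → ℚ) → Cube n → ℚ
Δ g x = g (true ∷ x) - g (false ∷ x)

signedTerm : ∀ {n} → Subset n → (Cube n → ℚ) → Cube n → Cube n → ℚ
signedTerm S g y z = if supportedIn S z then sign (∣ S ∣ ∸ card z) * g (override S z y) else 0ℚ

signedSum : ∀ {n} → Subset n → (Cube n → ℚ) → Cube n → ℚ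
signedSum {n} S g y = Σ[ allPoints n ] (signedTerm S g y)

supportedIn⇒card≤ : ∀ {n} (S z : Subset n) → supportedIn S z ≡ true → card z ℕ.≤ ∣ S ∣
supportedIn⇒card≤ []          []          _   = z≤n
supportedIn⇒card≤ (false ∷ S) (false ∷ z) z⊆S = supportedIn⇒card≤ S z z⊆S
supportedIn⇒card≤ (true ∷ S)  (false ∷ z) z⊆S = ℕₚ.m≤n⇒m≤1+n (supportedIn⇒card≤ S z z⊆S)
supportedIn⇒card≤ (true ∷ S)  (true ∷ z)  z⊆S = s≤s (supportedIn⇒card≤ S z z⊆S)

sign-suc : ∀ {s c} → c ℕ.≤ s → sign (suc s ∸ c) ≡ - sign (s ∸ c)
sign-suc c≤s rewrite ℕₚ.+-∸-assoc 1 c≤s = refl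

signedSum-[] : (g : Cube 0 → ℚ) → signedSum [] g [] ≡ g []
signedSum-[] g = trans (+-identityʳ _) (*-identityˡ (g []))

signedSum-∉ : ∀ {n} (S : Subset n) g b y → signedSum (false ∷ S) g (b ∷ y) ≡ signedSum S (g ∘ (b ∷_)) y
signedSum-∉ {n} S g b y =
  trans (Σ-allPoints (signedTerm (false ∷ S) g (b ∷ y)))
        (trans (cong (_+_ (signedSum S (g ∘ (b ∷_)) y)) (Σ-zero (allPoints n))) (+-identityʳ _))

signedSum-∈ : ∀ {n} (S : Subset n) g b y → signedSum (true ∷ S) g (b ∷ y) ≡ signedSum S (Δ g) y
signedSum-∈ {n} S g b y =
  trans (Σ-allPoints (signedTerm (true ∷ S) g (b ∷ y)))
        (trans (sym (Σ-+ (allPoints n) _ _)) (Σ-cong (allPoints n) pair))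
  where
  pair : ∀ z → signedTerm (true ∷ S) g (b ∷ y) (false ∷ z) + signedTerm (true ∷ S) g (b ∷ y) (true ∷ z)
             ≡ signedTerm S (Δ g) y z
  pair z with supportedIn S z in z⊆S
  ... | true  = alternate _ _ (sign-suc (supportedIn⇒card≤ S z z⊆S))
    where
    alternate : ∀ {σ σ′} a b → σ′ ≡ - σ → σ′ * a + σ * b ≡ σ * (b - a)
    alternate {σ} a b refl = identity σ a b
      where
      identity : ∀ σ a b → - σ * a + σ * b ≡ σ * (b - a)
      identity = solve-∀ ℚ-ring
  ... | false = refl

module Biased (p : ℚ) where

  σ² : ℚ
  σ² = p * (1ℚ - p)

  mix : ℚ → ℚ → ℚ
  mix a b = (1ℚ - p) * a + p * b

  mix-self : ∀ a → mix a a ≡ a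
  mix-self = identity p
    where
    identity : ∀ p a → (1ℚ - p) * a + p * a ≡ a
    identity = solve-∀ ℚ-ring

  mix-+ : ∀ a b a′ b′ → mix (a + a′) (b + b′) ≡ mix a b + mix a′ b′
  mix-+ = identity p
    where
    identity : ∀ p a b a′ b′ → (1ℚ - p) * (a + a′) + p * (b + b′) ≡ ((1ℚ - p) * a + p * b) + ((1ℚ - p) * a′ + p * b′)
    identity = solve-∀ ℚ-ring

  mix-scale : ∀ c a b → mix (c * a) (c * b) ≡ c * mix a b
  mix-scale = identity p
    where
    identity : ∀ p c a b → (1ℚ - p) * (c * a) + p * (c * b) ≡ c * ((1ℚ - p) * a + p * b)
    identity = solve-∀ ℚ-ring

  mix-linear : ∀ c d a b a′ b′ → mix (c * a + d * a′) (c * b + d * b′) ≡ c * mix a b + d * mix a′ b′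
  mix-linear c d a b a′ b′ = trans (mix-+ (c * a) (c * b) (d * a′) (d * b′)) (cong₂ _+_ (mix-scale c a b) (mix-scale d a′ b′))

  mix-interchange : ∀ a b c d → mix (mix a b) (mix c d) ≡ mix (mix a c) (mix b d)
  mix-interchange = identity p
    where
    identity : ∀ p a b c d → (1ℚ - p) * ((1ℚ - p) * a + p * b) + p * ((1ℚ - p) * c + p * d)
                           ≡ (1ℚ - p) * ((1ℚ - p) * a + p * c) + p * ((1ℚ - p) * b + p * d)
    identity = solve-∀ ℚ-ring

  avg : ∀ {n} → (Cube (suc n) → ℚ) → Cube n → ℚ
  avg g x = mix (g (false ∷ x)) (g (true ∷ x))

  E : ∀ {n} → (Cube n → ℚ) → ℚ
  E {zero}  g = g []
  E {suc n} g = mix (E (g ∘ (false ∷_))) (E (g ∘ (true ∷_)))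

  𝔼≡E : ∀ {n} (g : Cube n → ℚ) → 𝔼[ p ] g ≡ E g
  𝔼≡E {zero}  g = trans (+-identityʳ _) (*-identityˡ (g []))
  𝔼≡E {suc n} g = trans (Σ-allPoints (λ x → weight p x * g x))
                        (cong₂ _+_ (weighted (1ℚ - p) (g ∘ (false ∷_))) (weighted p (g ∘ (true ∷_))))
    where
    weighted : ∀ c h → Σ[ allPoints n ] (λ x → c * weight p x * h x) ≡ c * E h
    weighted c h = trans (Σ-cong (allPoints n) (λ x → *-assoc c (weight p x) (h x)))
                         (trans (Σ-scale (allPoints n) c _) (cong (c *_) (𝔼≡E h)))

  E-cong : ∀ {n} {g h : Cube n → ℚ} → (∀ x → g x ≡ h x) → E g ≡ E h
  E-cong {zero}  g≗h = g≗h []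
  E-cong {suc n} g≗h = cong₂ mix (E-cong (g≗h ∘ (false ∷_))) (E-cong (g≗h ∘ (true ∷_)))

  E-linear : ∀ {n} c d (g h : Cube n → ℚ) → E (λ x → c * g x + d * h x) ≡ c * E g + d * E h
  E-linear {zero}  c d g h = refl
  E-linear {suc n} c d g h = trans (cong₂ mix (E-linear c d (g ∘ (false ∷_)) (h ∘ (false ∷_))) (E-linear c d (g ∘ (true ∷_)) (h ∘ (true ∷_))))
          (mix-linear c d _ _ _ _)

  E-scale : ∀ {n} c (g : Cube n → ℚ) → E (λ x → c * g x) ≡ c * E g
  E-scale {zero}  c g = refl
  E-scale {suc n} c g = trans (cong₂ mix (E-scale c (g ∘ (false ∷_))) (E-scale c (g ∘ (true ∷_)))) (mix-scale c _ _)

  influence : ∀ {n} → Subset n → (Cube n → ℚ) → ℚ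
  influence []          g = g [] * g []
  influence (false ∷ S) g = mix (influence S (g ∘ (false ∷_))) (influence S (g ∘ (true ∷_)))
  influence (true ∷ S)  g = influence S (Δ g)

  influence-cong : ∀ {n} (S : Subset n) {g h} → (∀ x → g x ≡ h x) → influence S g ≡ influence S h
  influence-cong []          g≗h = cong₂ _*_ (g≗h []) (g≗h [])
  influence-cong (false ∷ S) g≗h = cong₂ mix (influence-cong S (g≗h ∘ (false ∷_))) (influence-cong S (g≗h ∘ (true ∷_)))
  influence-cong (true ∷ S)  g≗h = influence-cong S (λ x → cong₂ _-_ (g≗h (true ∷ x)) (g≗h (false ∷ x)))

  E-signedSum² : ∀ {n} (S : Subset n) g → E (λ y → signedSum S g y * signedSum S g y) ≡ influence S g
  E-signedSum² []          g = cong₂ _*_ (signedSum-[] g) (signedSum-[] g)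
  E-signedSum² (false ∷ S) g = cong₂ mix (slice false) (slice true)
    where
    slice : ∀ b → E (λ y → signedSum (false ∷ S) g (b ∷ y) * signedSum (false ∷ S) g (b ∷ y)) ≡ influence S (g ∘ (b ∷_))
    slice b = trans (E-cong (λ y → cong₂ _*_ (signedSum-∉ S g b y) (signedSum-∉ S g b y))) (E-signedSum² S (g ∘ (b ∷_)))
  E-signedSum² (true ∷ S)  g = trans (cong₂ mix (slice false) (slice true)) (mix-self _)
    where
    slice : ∀ b → E (λ y → signedSum (true ∷ S) g (b ∷ y) * signedSum (true ∷ S) g (b ∷ y)) ≡ influence S (Δ g)
    slice b = trans (E-cong (λ y → cong₂ _*_ (signedSum-∈ S g b y) (signedSum-∈ S g b y))) (E-signedSum² S (Δ g))

  I≡influence : ∀ {n} (S : Subset n) g → I[ p , S ] g ≡ influence S g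
  I≡influence {n} S g =
    trans (𝔼≡E (λ y → alternating y * alternating y))
          (trans (E-cong (λ y → cong₂ _*_ (alternating≡signedSum y) (alternating≡signedSum y))) (E-signedSum² S g))
    where
    alternating : Cube n → ℚ
    alternating y = Σ[ assignments S ] (λ z → sign (∣ S ∣ ∸ card z) * restrict S z g y)
    alternating≡signedSum : ∀ y → alternating y ≡ signedSum S g y
    alternating≡signedSum y = Σ-filterᵇ (supportedIn S) (allPoints n) _

  headExpansion : ∀ {n} → (Cube n → ℚ) → (Cube n → ℚ) → Cube (suc n) → ℚ
  headExpansion A C (b ∷ x) = A x + (bit b - p) * C x

  headExpansion-avg-Δ : ∀ {n} (g : Cube (suc n) → ℚ) y → headExpansion (avg g) (Δ g) y ≡ g y
  headExpansion-avg-Δ g (false ∷ x) = at₀ p (g (false ∷ x)) (g (true ∷ x))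
    where
    at₀ : ∀ p a b → ((1ℚ - p) * a + p * b) + (0ℚ - p) * (b - a) ≡ a
    at₀ = solve-∀ ℚ-ring
  headExpansion-avg-Δ g (true ∷ x)  = at₁ p (g (false ∷ x)) (g (true ∷ x))
    where
    at₁ : ∀ p a b → ((1ℚ - p) * a + p * b) + (1ℚ - p) * (b - a) ≡ b
    at₁ = solve-∀ ℚ-ring

  Δ-headExpansion : ∀ {n} (A C : Cube n → ℚ) x → Δ (headExpansion A C) x ≡ C x
  Δ-headExpansion A C x = identity p (A x) (C x)
    where
    identity : ∀ p a c → (a + (1ℚ - p) * c) - (a + (0ℚ - p) * c) ≡ c
    identity = solve-∀ ℚ-ring

  -- The cross terms cancel because E[x₁ - p] = 0.
  influence-headExpansion : ∀ {n} (S : Subset n) A C →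
                            influence (false ∷ S) (headExpansion A C) ≡ influence S A + σ² * influence S C
  influence-headExpansion []          A C = identity p (A []) (C [])
    where
    identity : ∀ p a c → (1ℚ - p) * ((a + (0ℚ - p) * c) * (a + (0ℚ - p) * c))
                         + p * ((a + (1ℚ - p) * c) * (a + (1ℚ - p) * c))
                       ≡ a * a + p * (1ℚ - p) * (c * c)
    identity = solve-∀ ℚ-ring
  influence-headExpansion (false ∷ S) A C =
    trans (mix-interchange _ _ _ _)
          (trans (cong₂ mix (influence-headExpansion S (A ∘ (false ∷_)) (C ∘ (false ∷_)))
                            (influence-headExpansion S (A ∘ (true ∷_)) (C ∘ (true ∷_))))
                 (trans (mix-+ a₀ a₁ (σ² * c₀) (σ² * c₁)) (cong (_+_ (mix a₀ a₁)) (mix-scale σ² c₀ c₁))))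
    where
    a₀ = influence S (A ∘ (false ∷_))
    a₁ = influence S (A ∘ (true ∷_))
    c₀ = influence S (C ∘ (false ∷_))
    c₁ = influence S (C ∘ (true ∷_))
  influence-headExpansion (true ∷ S)  A C =
    trans (cong₂ mix (influence-cong S (Δ-slice false)) (influence-cong S (Δ-slice true)))
          (influence-headExpansion S (Δ A) (Δ C))
    where
    Δ-slice : ∀ b x → Δ (headExpansion A C ∘ (b ∷_)) x ≡ headExpansion (Δ A) (Δ C) (b ∷ x)
    Δ-slice b x = Δ-linear (bit b - p) (A (true ∷ x)) (A (false ∷ x)) (C (true ∷ x)) (C (false ∷ x))
      where
      Δ-linear : ∀ k a₁ a₀ c₁ c₀ → (a₁ + k * c₁) - (a₀ + k * c₀) ≡ (a₁ - a₀) + k * (c₁ - c₀)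
      Δ-linear = solve-∀ ℚ-ring

  influence-split : ∀ {n} (S : Subset n) g → influence (false ∷ S) g ≡ influence S (avg g) + σ² * influence S (Δ g)
  influence-split S g = trans (sym (influence-cong (false ∷ S) (headExpansion-avg-Δ g))) (influence-headExpansion S (avg g) (Δ g))

  influence-zero : ∀ {n} (S : Subset n) → influence S (λ _ → 0ℚ) ≡ 0ℚ
  influence-zero []          = refl
  influence-zero (false ∷ S) = trans (cong₂ mix (influence-zero S) (influence-zero S)) (mix-self 0ℚ)
  influence-zero (true ∷ S)  = influence-zero S

  correlation : ∀ {n} → (Cube n → ℚ) → Subset n → ℚ
  correlation g T = 𝔼[ p ] (λ y → g y * centered p T y)

  correlation-∉ : ∀ {n} (g : Cube (suc n) → ℚ) T → correlation g (false ∷ T) ≡ correlation (avg g) T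
  correlation-∉ g T = begin
    correlation g (false ∷ T)
      ≡⟨ 𝔼≡E (λ y → g y * centered p (false ∷ T) y) ⟩
    mix (E (λ x → g (false ∷ x) * (1ℚ * c x))) (E (λ x → g (true ∷ x) * (1ℚ * c x)))
      ≡⟨ cong₂ mix (E-cong (λ x → cong (g (false ∷ x) *_) (*-identityˡ (c x))))
                   (E-cong (λ x → cong (g (true ∷ x) *_) (*-identityˡ (c x)))) ⟩
    mix (E (λ x → g (false ∷ x) * c x)) (E (λ x → g (true ∷ x) * c x))
      ≡⟨ sym (E-linear (1ℚ - p) p (λ x → g (false ∷ x) * c x) (λ x → g (true ∷ x) * c x)) ⟩
    E (λ x → mix (g (false ∷ x) * c x) (g (true ∷ x) * c x))
      ≡⟨ E-cong (λ x → mix-*ʳ p (g (false ∷ x)) (g (true ∷ x)) (c x)) ⟩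
    E (λ x → avg g x * c x)
      ≡⟨ sym (𝔼≡E (λ x → avg g x * c x)) ⟩
    correlation (avg g) T ∎
    where
    open ≡-Reasoning
    c = centered p T
    mix-*ʳ : ∀ p a b c → (1ℚ - p) * (a * c) + p * (b * c) ≡ ((1ℚ - p) * a + p * b) * c
    mix-*ʳ = solve-∀ ℚ-ring

  correlation-∈ : ∀ {n} (g : Cube (suc n) → ℚ) T → correlation g (true ∷ T) ≡ σ² * correlation (Δ g) T
  correlation-∈ g T = begin
    correlation g (true ∷ T)
      ≡⟨ 𝔼≡E (λ y → g y * centered p (true ∷ T) y) ⟩
    mix (E (λ x → g (false ∷ x) * ((0ℚ - p) * c x))) (E (λ x → g (true ∷ x) * ((1ℚ - p) * c x)))
      ≡⟨ cong₂ mix (trans (E-cong (λ x → *-leftComm (g (false ∷ x)) (0ℚ - p) (c x))) (E-scale (0ℚ - p) k₀))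
                   (trans (E-cong (λ x → *-leftComm (g (true ∷ x)) (1ℚ - p) (c x))) (E-scale (1ℚ - p) k₁)) ⟩
    mix ((0ℚ - p) * E k₀) ((1ℚ - p) * E k₁)
      ≡⟨ factor p (E k₀) (E k₁) ⟩
    σ² * (1ℚ * E k₁ + (- 1ℚ) * E k₀)
      ≡⟨ cong (σ² *_) (sym (E-linear 1ℚ (- 1ℚ) k₁ k₀)) ⟩
    σ² * E (λ x → 1ℚ * k₁ x + (- 1ℚ) * k₀ x)
      ≡⟨ cong (σ² *_) (E-cong (λ x → Δ-* (g (true ∷ x)) (g (false ∷ x)) (c x))) ⟩
    σ² * E (λ x → Δ g x * c x)
      ≡⟨ cong (σ² *_) (sym (𝔼≡E (λ x → Δ g x * c x))) ⟩
    σ² * correlation (Δ g) T ∎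
    where
    open ≡-Reasoning
    c = centered p T
    k₀ k₁ : _ → ℚ
    k₀ x = g (false ∷ x) * c x
    k₁ x = g (true ∷ x) * c x
    *-leftComm : ∀ a k c → a * (k * c) ≡ k * (a * c)
    *-leftComm = solve-∀ ℚ-ring
    factor : ∀ p u v → (1ℚ - p) * ((0ℚ - p) * u) + p * ((1ℚ - p) * v) ≡ p * (1ℚ - p) * (1ℚ * v + (- 1ℚ) * u)
    factor = solve-∀ ℚ-ring
    Δ-* : ∀ a b c → 1ℚ * (a * c) + (- 1ℚ) * (b * c) ≡ (a - b) * c
    Δ-* = solve-∀ ℚ-ring

  fourierTerm-∉ : ∀ {n} (g : Cube (suc n) → ℚ) T b x → fourierTerm p g (false ∷ T) (b ∷ x) ≡ fourierTerm p (avg g) T x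
  fourierTerm-∉ g T b x = cong₂ (λ u v → inv (σ² ^ℚ ∣ T ∣) * u * v) (correlation-∉ g T) (*-identityˡ _)

  lowDeg< : ∀ {n} → ℕ → (Cube n → ℚ) → Cube n → ℚ
  lowDeg< zero    g x = 0ℚ
  lowDeg< (suc r) g   = lowDeg p r g

  lowDeg-[] : ∀ r (g : Cube 0 → ℚ) → lowDeg p r g [] ≡ g []
  lowDeg-[] r g = identity (g [])
    where
    identity : ∀ a → 1ℚ * (1ℚ * (a * 1ℚ) + 0ℚ) * 1ℚ + 0ℚ ≡ a
    identity = solve-∀ ℚ-ring

  module _ (0<σ² : 0ℚ < σ²) where

    fourierTerm-∈ : ∀ {n} (g : Cube (suc n) → ℚ) T b x →
                    fourierTerm p g (true ∷ T) (b ∷ x) ≡ (bit b - p) * fourierTerm p (Δ g) T x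
    fourierTerm-∈ g T b x = begin
      inv (σ² * e) * correlation g (true ∷ T) * (χ * c)
        ≡⟨ cong (λ u → inv (σ² * e) * u * (χ * c)) (correlation-∈ g T) ⟩
      inv (σ² * e) * (σ² * X) * (χ * c)
        ≡⟨ regroup (inv (σ² * e)) σ² X χ c ⟩
      χ * (inv (σ² * e) * σ² * X * c)
        ≡⟨ cong (λ i → χ * (i * X * c)) (inv-*-cancelˡ σ² e (nonZero (suc ∣ T ∣)) (nonZero ∣ T ∣)) ⟩
      χ * (inv e * X * c) ∎
      where
      open ≡-Reasoning
      e = σ² ^ℚ ∣ T ∣
      χ = bit b - p
      c = centered p T x
      X = correlation (Δ g) T
      nonZero : ∀ k → σ² ^ℚ k ≢ 0ℚ
      nonZero k = ≢-sym (<⇒≢ (^ℚ-pos 0<σ² k))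
      regroup : ∀ i s X χ c → i * (s * X) * (χ * c) ≡ χ * (i * s * X * c)
      regroup = solve-∀ ℚ-ring

    lowDeg-∷ : ∀ {n} r (g : Cube (suc n) → ℚ) y → lowDeg p r g y ≡ headExpansion (lowDeg p r (avg g)) (lowDeg< r (Δ g)) y
    lowDeg-∷ {n} r g (b ∷ x) =
      trans (Σ-allPoints (λ S → if ∣ S ∣ ℕ.≤ᵇ r then fourierTerm p g S (b ∷ x) else 0ℚ))
            (cong₂ _+_ (Σ-cong (allPoints n) (λ T → cong (λ t → if ∣ T ∣ ℕ.≤ᵇ r then t else 0ℚ) (fourierTerm-∉ g T b x)))
                       (higher r))
      where
      higher : ∀ r → Σ[ allPoints n ] (λ T → if suc ∣ T ∣ ℕ.≤ᵇ r then fourierTerm p g (true ∷ T) (b ∷ x) else 0ℚ)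
                     ≡ (bit b - p) * lowDeg< r (Δ g) x
      higher zero    = trans (Σ-zero (allPoints n)) (sym (*-zeroʳ (bit b - p)))
      higher (suc r) = trans (Σ-cong (allPoints n) term) (Σ-scale (allPoints n) (bit b - p) _)
        where
        ≤ᵇ-suc : ∀ m → (suc m ℕ.≤ᵇ suc r) ≡ (m ℕ.≤ᵇ r)
        ≤ᵇ-suc zero    = refl
        ≤ᵇ-suc (suc m) = refl
        term : ∀ T → (if suc ∣ T ∣ ℕ.≤ᵇ suc r then fourierTerm p g (true ∷ T) (b ∷ x) else 0ℚ)
                     ≡ (bit b - p) * (if ∣ T ∣ ℕ.≤ᵇ r then fourierTerm p (Δ g) T x else 0ℚ)
        term T rewrite ≤ᵇ-suc ∣ T ∣ with ∣ T ∣ ℕ.≤ᵇ r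
        ... | true  = fourierTerm-∈ g T b x
        ... | false = sym (*-zeroʳ (bit b - p))

  -- Σ_{z ∈ {0,1}^S} E[g_{S→z}]
  sliceSum : ∀ {n} → Subset n → (Cube n → ℚ) → ℚ
  sliceSum []          g = g []
  sliceSum (false ∷ S) g = sliceSum S (avg g)
  sliceSum (true ∷ S)  g = sliceSum S (λ x → g (false ∷ x) + g (true ∷ x))

  sliceSum-cong : ∀ {n} (S : Subset n) {g h} → (∀ x → g x ≡ h x) → sliceSum S g ≡ sliceSum S h
  sliceSum-cong []          g≗h = g≗h []
  sliceSum-cong (false ∷ S) g≗h = sliceSum-cong S (λ x → cong₂ mix (g≗h (false ∷ x)) (g≗h (true ∷ x)))
  sliceSum-cong (true ∷ S)  g≗h = sliceSum-cong S (λ x → cong₂ _+_ (g≗h (false ∷ x)) (g≗h (true ∷ x)))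

  sliceSum-+ : ∀ {n} (S : Subset n) g h → sliceSum S (λ x → g x + h x) ≡ sliceSum S g + sliceSum S h
  sliceSum-+ []          g h = refl
  sliceSum-+ (false ∷ S) g h =
    trans (sliceSum-cong S (λ x → mix-+ (g (false ∷ x)) (g (true ∷ x)) (h (false ∷ x)) (h (true ∷ x))))
          (sliceSum-+ S (avg g) (avg h))
  sliceSum-+ (true ∷ S)  g h =
    trans (sliceSum-cong S (λ x → interchange (g (false ∷ x)) (h (false ∷ x)) (g (true ∷ x)) (h (true ∷ x))))
          (sliceSum-+ S _ _)
    where
    interchange : ∀ a b c d → a + b + (c + d) ≡ a + c + (b + d)
    interchange = solve-∀ ℚ-ring

  sliceSum-scale : ∀ {n} (S : Subset n) c g → sliceSum S (λ x → c * g x) ≡ c * sliceSum S g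
  sliceSum-scale []          c g = refl
  sliceSum-scale (false ∷ S) c g =
    trans (sliceSum-cong S (λ x → mix-scale c (g (false ∷ x)) (g (true ∷ x)))) (sliceSum-scale S c (avg g))
  sliceSum-scale (true ∷ S)  c g =
    trans (sliceSum-cong S (λ x → sym (*-distribˡ-+ c (g (false ∷ x)) (g (true ∷ x))))) (sliceSum-scale S c _)

  sliceSum-mix : ∀ {n} (S : Subset n) g h → sliceSum S (λ x → mix (g x) (h x)) ≡ mix (sliceSum S g) (sliceSum S h)
  sliceSum-mix S g h = trans (sliceSum-+ S _ _) (cong₂ _+_ (sliceSum-scale S (1ℚ - p) g) (sliceSum-scale S p h))

module Bounds (p : ℚ) (0≤p : 0ℚ ≤ p) (0≤1-p : 0ℚ ≤ 1ℚ - p) where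
  open Biased p

  mix-mono-≤ : ∀ {a a′ b b′} → a ≤ a′ → b ≤ b′ → mix a b ≤ mix a′ b′
  mix-mono-≤ a≤a′ b≤b′ = +-mono-≤ (*-monoˡ-≤-0≤ 0≤1-p a≤a′) (*-monoˡ-≤-0≤ 0≤p b≤b′)

  mix-nonNeg : ∀ {a b} → 0ℚ ≤ a → 0ℚ ≤ b → 0ℚ ≤ mix a b
  mix-nonNeg 0≤a 0≤b = +-mono-≤ (*-nonNeg 0≤1-p 0≤a) (*-nonNeg 0≤p 0≤b)

  influence-nonNeg : ∀ {n} (S : Subset n) g → 0ℚ ≤ influence S g
  influence-nonNeg []          g = square-nonNeg (g [])
  influence-nonNeg (false ∷ S) g = mix-nonNeg (influence-nonNeg S _) (influence-nonNeg S _)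
  influence-nonNeg (true ∷ S)  g = influence-nonNeg S (Δ g)

  sliceSum-mono-≤ : ∀ {n} (S : Subset n) {g h} → (∀ x → g x ≤ h x) → sliceSum S g ≤ sliceSum S h
  sliceSum-mono-≤ []          g≤h = g≤h []
  sliceSum-mono-≤ (false ∷ S) g≤h = sliceSum-mono-≤ S (λ x → mix-mono-≤ (g≤h (false ∷ x)) (g≤h (true ∷ x)))
  sliceSum-mono-≤ (true ∷ S)  g≤h = sliceSum-mono-≤ S (λ x → +-mono-≤ (g≤h (false ∷ x)) (g≤h (true ∷ x)))

  module _ (0<σ² : 0ℚ < σ²) where

    influence-lowDeg-≤  : ∀ {n} (S : Subset n) r g → influence S (lowDeg p r g) ≤ influence S g
    influence-lowDeg<-≤ : ∀ {n} (S : Subset n) r g → influence S (lowDeg< r g) ≤ influence S g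

    influence-lowDeg-≤ []          r g = ≤-reflexive (cong (λ a → a * a) (lowDeg-[] r g))
    influence-lowDeg-≤ (false ∷ S) r g = begin
      influence (false ∷ S) (lowDeg p r g)
        ≡⟨ influence-cong (false ∷ S) (lowDeg-∷ 0<σ² r g) ⟩
      influence (false ∷ S) (headExpansion (lowDeg p r (avg g)) (lowDeg< r (Δ g)))
        ≡⟨ influence-headExpansion S _ _ ⟩
      influence S (lowDeg p r (avg g)) + σ² * influence S (lowDeg< r (Δ g))
        ≤⟨ +-mono-≤ (influence-lowDeg-≤ S r (avg g)) (*-monoˡ-≤-0≤ (<⇒≤ 0<σ²) (influence-lowDeg<-≤ S r (Δ g))) ⟩
      influence S (avg g) + σ² * influence S (Δ g)
        ≡⟨ influence-split S g ⟨
      influence (false ∷ S) g ∎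
      where open ≤-Reasoning
    influence-lowDeg-≤ (true ∷ S)  r g = begin
      influence S (Δ (lowDeg p r g))
        ≡⟨ influence-cong S Δ-lowDeg ⟩
      influence S (lowDeg< r (Δ g))
        ≤⟨ influence-lowDeg<-≤ S r (Δ g) ⟩
      influence S (Δ g) ∎
      where
      open ≤-Reasoning
      Δ-lowDeg : ∀ x → Δ (lowDeg p r g) x ≡ lowDeg< r (Δ g) x
      Δ-lowDeg x = trans (cong₂ _-_ (lowDeg-∷ 0<σ² r g (true ∷ x)) (lowDeg-∷ 0<σ² r g (false ∷ x)))
                         (Δ-headExpansion (lowDeg p r (avg g)) (lowDeg< r (Δ g)) x)

    influence-lowDeg<-≤ S zero    g = subst (_≤ influence S g) (sym (influence-zero S)) (influence-nonNeg S g)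
    influence-lowDeg<-≤ S (suc r) g = influence-lowDeg-≤ S r g

  influence-∉-≤ : ∀ {n} (S : Subset n) K g →
                  (∀ b → influence S (g ∘ (b ∷_)) ≤ K * sliceSum S (λ x → g (b ∷ x) * g (b ∷ x))) →
                  influence (false ∷ S) g ≤ K * sliceSum (false ∷ S) (λ x → g x * g x)
  influence-∉-≤ S K g slice≤ = begin
    mix (influence S (g ∘ (false ∷_))) (influence S (g ∘ (true ∷_)))
      ≤⟨ mix-mono-≤ (slice≤ false) (slice≤ true) ⟩
    mix (K * sliceSum S (square false)) (K * sliceSum S (square true))
      ≡⟨ mix-scale K _ _ ⟩
    K * mix (sliceSum S (square false)) (sliceSum S (square true))
      ≡⟨ cong (K *_) (sliceSum-mix S (square false) (square true)) ⟨
    K * sliceSum S (avg (λ x → g x * g x)) ∎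
    where
    open ≤-Reasoning
    square : Bool → _ → ℚ
    square b x = g (b ∷ x) * g (b ∷ x)

  influence-≤-sliceSum : ∀ {n} (S : Subset n) u → influence S u ≤ fromℕ (2 ^ ∣ S ∣) * sliceSum S (λ x → u x * u x)
  influence-≤-sliceSum []          u = ≤-reflexive (sym (*-identityˡ _))
  influence-≤-sliceSum (false ∷ S) u = influence-∉-≤ S (fromℕ (2 ^ ∣ S ∣)) u (λ b → influence-≤-sliceSum S (u ∘ (b ∷_)))
  influence-≤-sliceSum (true ∷ S)  u = begin
    influence S (Δ u)
      ≤⟨ influence-≤-sliceSum S (Δ u) ⟩
    K * sliceSum S (λ x → Δ u x * Δ u x)
      ≤⟨ *-monoˡ-≤-0≤ (fromℕ-nonNeg (2 ^ ∣ S ∣)) (sliceSum-mono-≤ S (λ x → Δ²≤ (u (false ∷ x)) (u (true ∷ x)))) ⟩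
    K * sliceSum S (λ x → (1ℚ + 1ℚ) * sumSq x)
      ≡⟨ cong (K *_) (sliceSum-scale S (1ℚ + 1ℚ) sumSq) ⟩
    K * ((1ℚ + 1ℚ) * sliceSum S sumSq)
      ≡⟨ trans (*-leftComm K (1ℚ + 1ℚ) _) (sym (*-assoc (1ℚ + 1ℚ) K _)) ⟩
    (1ℚ + 1ℚ) * K * sliceSum S sumSq
      ≡⟨ cong (_* sliceSum S sumSq) (fromℕ-* 2 (2 ^ ∣ S ∣)) ⟨
    fromℕ (2 ^ suc ∣ S ∣) * sliceSum S sumSq ∎
    where
    open ≤-Reasoning
    K = fromℕ (2 ^ ∣ S ∣)
    sumSq : _ → ℚ
    sumSq x = u (false ∷ x) * u (false ∷ x) + u (true ∷ x) * u (true ∷ x)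
    *-leftComm : ∀ a b c → a * (b * c) ≡ b * (a * c)
    *-leftComm = solve-∀ ℚ-ring
    Δ²≤ : ∀ a b → (b - a) * (b - a) ≤ (1ℚ + 1ℚ) * (a * a + b * b)
    Δ²≤ a b = ≤-by-nonNeg-gap ((a + b) * (a + b)) (gap a b) (square-nonNeg (a + b))
      where
      gap : ∀ a b → (1ℚ + 1ℚ) * (a * a + b * b) ≡ (b - a) * (b - a) + (a + b) * (a + b)
      gap = solve-∀ ℚ-ring

  -- For nonnegative g, (g₁ - g₀)² ≤ g₀² + g₁² saves the factor 2 at one coordinate of S.
  influence-≤-sliceSum-nonNeg : ∀ {n} (S : Subset n) g → (∀ x → 0ℚ ≤ g x) →
                                influence S g ≤ fromℕ (2 ^ (∣ S ∣ ∸ 1)) * sliceSum S (λ x → g x * g x)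
  influence-≤-sliceSum-nonNeg []          g 0≤g = ≤-reflexive (sym (*-identityˡ _))
  influence-≤-sliceSum-nonNeg (false ∷ S) g 0≤g =
    influence-∉-≤ S (fromℕ (2 ^ (∣ S ∣ ∸ 1))) g (λ b → influence-≤-sliceSum-nonNeg S (g ∘ (b ∷_)) (0≤g ∘ (b ∷_)))
  influence-≤-sliceSum-nonNeg (true ∷ S)  g 0≤g = begin
    influence S (Δ g)
      ≤⟨ influence-≤-sliceSum S (Δ g) ⟩
    fromℕ (2 ^ ∣ S ∣) * sliceSum S (λ x → Δ g x * Δ g x)
      ≤⟨ *-monoˡ-≤-0≤ (fromℕ-nonNeg (2 ^ ∣ S ∣)) (sliceSum-mono-≤ S (λ x → Δ²≤ (0≤g (false ∷ x)) (0≤g (true ∷ x)))) ⟩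
    fromℕ (2 ^ ∣ S ∣) * sliceSum S (λ x → g (false ∷ x) * g (false ∷ x) + g (true ∷ x) * g (true ∷ x)) ∎
    where
    open ≤-Reasoning
    Δ²≤ : ∀ {a b} → 0ℚ ≤ a → 0ℚ ≤ b → (b - a) * (b - a) ≤ a * a + b * b
    Δ²≤ {a} {b} 0≤a 0≤b = ≤-by-nonNeg-gap ((1ℚ + 1ℚ) * (a * b)) (gap a b) (*-nonNeg (fromℕ-nonNeg 2) (*-nonNeg 0≤a 0≤b))
      where
      gap : ∀ a b → a * a + b * b ≡ (b - a) * (b - a) + (1ℚ + 1ℚ) * (a * b)
      gap = solve-∀ ℚ-ring

  avg-nonNeg : ∀ {n} (g : Cube (suc n) → ℚ) → (∀ x → 0ℚ ≤ g x) → ∀ x → 0ℚ ≤ avg g x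
  avg-nonNeg g 0≤g x = mix-nonNeg (0≤g (false ∷ x)) (0≤g (true ∷ x))

  E-restrict1-avg : ∀ {n} (J : Subset n) g → E (restrict1 J (avg g)) ≡ E (restrict1 (false ∷ J) g)
  E-restrict1-avg {n} J g = E-linear (1ℚ - p) p (λ x → g (false ∷ override J (ones n) x)) (λ x → g (true ∷ override J (ones n) x))

  module _ (2p≤1 : p + p ≤ 1ℚ) where

    -- The only use of p ≤ ½: for g ≥ 0, g(0,x) ≤ 2 · avg g x.
    slices≤ : ∀ {a b} → 0ℚ ≤ a → 0ℚ ≤ b → a + b ≤ (1ℚ + 1ℚ) * mix a b + b
    slices≤ {a} {b} 0≤a 0≤b =
      ≤-by-nonNeg-gap ((1ℚ - (p + p)) * a + (p + p) * b) (gap p a b)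
                      (+-mono-≤ (*-nonNeg 0≤1-2p 0≤a) (*-nonNeg (+-mono-≤ 0≤p 0≤p) 0≤b))
      where
      0≤1-2p : 0ℚ ≤ 1ℚ - (p + p)
      0≤1-2p = subst (_≤ 1ℚ - (p + p)) (+-inverseʳ (p + p)) (+-monoˡ-≤ (- (p + p)) 2p≤1)
      gap : ∀ p a b → (1ℚ + 1ℚ) * ((1ℚ - p) * a + p * b) + b ≡ (a + b) + ((1ℚ - (p + p)) * a + (p + p) * b)
      gap = solve-∀ ℚ-ring

    -- sliceSum S g is at most Σ_{J ⊆ S} 2^{|S∖J|} E[g_{J→1}], and these weights sum to 3^{|S|}.
    sliceSum-≤ : ∀ {n} (S : Subset n) k M g → (∀ x → 0ℚ ≤ g x) → ∣ S ∣ ℕ.≤ k →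
                 (∀ (J : Subset n) → ∣ J ∣ ℕ.≤ k → E (restrict1 J g) ≤ M) →
                 sliceSum S g ≤ fromℕ (3 ^ ∣ S ∣) * M
    sliceSum-≤ []          k       M g 0≤g _          bounded = ≤-trans (bounded [] z≤n) (≤-reflexive (sym (*-identityˡ M)))
    sliceSum-≤ (false ∷ S) k       M g 0≤g |S|≤k      bounded =
      sliceSum-≤ S k M (avg g) (avg-nonNeg g 0≤g) |S|≤k
                 (λ J |J|≤k → ≤-trans (≤-reflexive (E-restrict1-avg J g)) (bounded (false ∷ J) |J|≤k))
    sliceSum-≤ (true ∷ S)  (suc k) M g 0≤g (s≤s |S|≤k) bounded = begin
      sliceSum S (λ x → g (false ∷ x) + g (true ∷ x))
        ≤⟨ sliceSum-mono-≤ S (λ x → slices≤ (0≤g (false ∷ x)) (0≤g (true ∷ x))) ⟩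
      sliceSum S (λ x → (1ℚ + 1ℚ) * avg g x + g (true ∷ x))
        ≡⟨ trans (sliceSum-+ S _ (g ∘ (true ∷_))) (cong (_+ sliceSum S (g ∘ (true ∷_))) (sliceSum-scale S (1ℚ + 1ℚ) (avg g))) ⟩
      (1ℚ + 1ℚ) * sliceSum S (avg g) + sliceSum S (g ∘ (true ∷_))
        ≤⟨ +-mono-≤ (*-monoˡ-≤-0≤ (fromℕ-nonNeg 2) bound₀) bound₁ ⟩
      (1ℚ + 1ℚ) * (T * M) + T * M
        ≡⟨ collect T M ⟩
      (1ℚ + 1ℚ + 1ℚ) * T * M
        ≡⟨ cong (_* M) (fromℕ-* 3 (3 ^ ∣ S ∣)) ⟨
      fromℕ (3 ^ suc ∣ S ∣) * M ∎
      where
      open ≤-Reasoning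
      T = fromℕ (3 ^ ∣ S ∣)
      bound₀ : sliceSum S (avg g) ≤ T * M
      bound₀ = sliceSum-≤ S (suc k) M (avg g) (avg-nonNeg g 0≤g) (ℕₚ.m≤n⇒m≤1+n |S|≤k)
                 (λ J |J|≤ → ≤-trans (≤-reflexive (E-restrict1-avg J g)) (bounded (false ∷ J) |J|≤))
      bound₁ : sliceSum S (g ∘ (true ∷_)) ≤ T * M
      bound₁ = sliceSum-≤ S k M (g ∘ (true ∷_)) (0≤g ∘ (true ∷_)) |S|≤k
                 (λ J |J|≤k → ≤-trans (≤-reflexive (sym (mix-self _))) (bounded (true ∷ J) (s≤s |J|≤k)))
      collect : ∀ T M → (1ℚ + 1ℚ) * (T * M) + T * M ≡ (1ℚ + 1ℚ + 1ℚ) * T * M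
      collect = solve-∀ ℚ-ring

^-distribʳ-* : ∀ a b t → a ^ t ℕ.* b ^ t ≡ (a ℕ.* b) ^ t
^-distribʳ-* a b zero    = refl
^-distribʳ-* a b (suc t) = trans (interchange a b (a ^ t) (b ^ t)) (cong ((a ℕ.* b) ℕ.*_) (^-distribʳ-* a b t))
  where
  interchange : ∀ a b x y → a ℕ.* x ℕ.* (b ℕ.* y) ≡ a ℕ.* b ℕ.* (x ℕ.* y)
  interchange = ℕ-Solver.solve-∀

2^[s∸1]*3^s*2≤8^r : ∀ {r} s → 1 ℕ.≤ r → s ℕ.≤ r → 2 ^ (s ∸ 1) ℕ.* 3 ^ s ℕ.* 2 ℕ.≤ 8 ^ r
2^[s∸1]*3^s*2≤8^r zero    1≤r _   = ℕₚ.≤-trans (ℕₚ.m≤m+n 2 6) (ℕₚ.^-monoʳ-≤ 8 1≤r)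
2^[s∸1]*3^s*2≤8^r {r} (suc t) _ s≤r = begin
  2 ^ t ℕ.* 3 ^ suc t ℕ.* 2  ≡⟨ regroup (2 ^ t) (3 ^ t) ⟩
  2 ^ suc t ℕ.* 3 ^ suc t    ≡⟨ ^-distribʳ-* 2 3 (suc t) ⟩
  6 ^ suc t                  ≤⟨ ℕₚ.^-monoˡ-≤ (suc t) (ℕₚ.m≤m+n 6 2) ⟩
  8 ^ suc t                  ≤⟨ ℕₚ.^-monoʳ-≤ 8 s≤r ⟩
  8 ^ r                      ∎
  where
  open ℕₚ.≤-Reasoning
  regroup : ∀ x y → x ℕ.* (3 ℕ.* y) ℕ.* 2 ≡ 2 ℕ.* x ℕ.* (3 ℕ.* y)
  regroup = ℕ-Solver.solve-∀

constant-≤ : ∀ {δ r} s → 0ℚ ≤ δ → 1 ℕ.≤ r → s ℕ.≤ r →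
             fromℕ (2 ^ (s ∸ 1)) * (fromℕ (3 ^ s) * (δ + δ)) ≤ fromℕ (8 ^ r) * δ
constant-≤ {δ} {r} s 0≤δ 1≤r s≤r = begin
  fromℕ a * (fromℕ b * (δ + δ))     ≡⟨ regroup (fromℕ a) (fromℕ b) δ ⟩
  fromℕ a * fromℕ b * fromℕ 2 * δ  ≡⟨ cong (_* δ) (trans (fromℕ-* (a ℕ.* b) 2) (cong (_* fromℕ 2) (fromℕ-* a b))) ⟨
  fromℕ (a ℕ.* b ℕ.* 2) * δ        ≤⟨ *-monoʳ-≤-nonNeg δ {{nonNegative 0≤δ}} (fromℕ-mono-≤ (2^[s∸1]*3^s*2≤8^r s 1≤r s≤r)) ⟩
  fromℕ (8 ^ r) * δ                ∎
  where
  open ≤-Reasoning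
  a = 2 ^ (s ∸ 1)
  b = 3 ^ s
  regroup : ∀ x y δ → x * (y * (δ + δ)) ≡ x * y * (1ℚ + 1ℚ) * δ
  regroup = solve-∀ ℚ-ring

lemma4p2 : (n : ℕ) (p : ℚ) (r : ℕ) (δ : ℚ) (f : Cube n → Bool) →
    0ℚ < p → p ≤ ½ → 1 Data.Nat.≤ r → 0ℚ < δ →
    IsGlobal p r δ (toℚ f) → μ p (toℚ f) ≤ δ →
    (S : Subset n) → ∣ S ∣ Data.Nat.≤ r →
    (I[ p , S ] (lowDeg p r (toℚ f)) ≤ I[ p , S ] (toℚ f))
      × (I[ p , S ] (toℚ f) ≤ ((+ (8 ^ r)) / 1) * δ)
lemma4p2 n p r δ f 0<p p≤½ 1≤r 0<δ global μ≤δ S |S|≤r = lowDeg-≤ , influence-≤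
  where
  open ≤-Reasoning
  open Biased p
  0<1-p : 0ℚ < 1ℚ - p
  0<1-p = p≤½⇒0<1-p p≤½
  open Bounds p (<⇒≤ 0<p) (<⇒≤ 0<1-p)
  F = toℚ f
  0≤F : ∀ x → 0ℚ ≤ F x
  0≤F x = bit-nonNeg (f x)
  s = ∣ S ∣

  lowDeg-≤ : I[ p , S ] (lowDeg p r F) ≤ I[ p , S ] F
  lowDeg-≤ = begin
    I[ p , S ] (lowDeg p r F)   ≡⟨ I≡influence S (lowDeg p r F) ⟩
    influence S (lowDeg p r F)  ≤⟨ influence-lowDeg-≤ (*-pos 0<p 0<1-p) S r F ⟩
    influence S F               ≡⟨ I≡influence S F ⟨
    I[ p , S ] F                ∎

  restrictions≤ : ∀ J → ∣ J ∣ Data.Nat.≤ r → E (restrict1 J F) ≤ δ + δ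
  restrictions≤ J |J|≤r = begin
    E (restrict1 J F)     ≡⟨ 𝔼≡E (restrict1 J F) ⟨
    μ p (restrict1 J F)   ≤⟨ global J |J|≤r ⟩
    μ p F + δ             ≤⟨ +-monoˡ-≤ δ μ≤δ ⟩
    δ + δ                 ∎

  influence-≤ : I[ p , S ] F ≤ fromℕ (8 ^ r) * δ
  influence-≤ = begin
    I[ p , S ] F                                       ≡⟨ I≡influence S F ⟩
    influence S F                                      ≤⟨ influence-≤-sliceSum-nonNeg S F 0≤F ⟩
    fromℕ (2 ^ (s ∸ 1)) * sliceSum S (λ x → F x * F x) ≡⟨ cong (fromℕ (2 ^ (s ∸ 1)) *_) (sliceSum-cong S (bit-square ∘ f)) ⟩
    fromℕ (2 ^ (s ∸ 1)) * sliceSum S F                 ≤⟨ *-monoˡ-≤-0≤ (fromℕ-nonNeg (2 ^ (s ∸ 1)))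
                                                            (sliceSum-≤ (+-mono-≤ p≤½ p≤½) S r (δ + δ) F 0≤F |S|≤r restrictions≤) ⟩
    fromℕ (2 ^ (s ∸ 1)) * (fromℕ (3 ^ s) * (δ + δ))    ≤⟨ constant-≤ s (<⇒≤ 0<δ) 1≤r |S|≤r ⟩
    fromℕ (8 ^ r) * δ                                  ∎
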